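{- A perfect cuboid exists if and only if there exist rational numbers $\alpha_2,\beta_2,\gamma_2\in\mathbb{Q}\setminus\{0,1,-1\}$ satisfying $$\Big(\frac{2\gamma_2}{1-\gamma_2^2}\Big)^2+\Big(\frac{2\beta_2}{1-\beta_2^2}\Big)^2=\Big(\frac{2\alpha_2}{1-\alpha_2^2}\Big)^2.$$
   Context: A perfect cuboid is a triple of positive rational numbers $a,b,c$ such that $a^2+b^2$, $b^2+c^2$, $a^2+c^2$ and $a^2+b^2+c^2$ are all squares of rational numbers. -}

module Defs where

open import Data.Rational using (ℚ; 0ℚ; 1ℚ; _+_; _*_; _-_; -_; _÷_; _≟_; ≢-nonZero)
open import Data.Product using (_×_; ∃-syntax)
open import Relation.Nullary using (yes; no; ¬_)
open import Relation.Binary.PropositionalEquality using (_≡_; _≢_)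

IsSquare : ℚ → Set
IsSquare q = ∃[ r ] (q ≡ r * r)

PerfectCuboid : ℚ → ℚ → ℚ → Set
PerfectCuboid a b c =
  (0ℚ Data.Rational.< a) × (0ℚ Data.Rational.< b) × (0ℚ Data.Rational.< c) ×
  IsSquare (a * a + b * b) × IsSquare (b * b + c * c) ×
  IsSquare (a * a + c * c) × IsSquare (a * a + b * b + c * c)

-- 2x / (1 - x²).  Total function: the value when 1 - x² = 0 is an
-- arbitrary junk value (0); it is only used for x ∉ {1, -1}.
T : ℚ → ℚ
T x with (1ℚ - x * x) ≟ 0ℚ
... | yes _ = 0ℚ
... | no ne = ((1ℚ + 1ℚ) * x ÷ (1ℚ - x * x)) {{≢-nonZero ne}}

Admissible : ℚ → Set
Admissible x = (x ≢ 0ℚ) × (x ≢ 1ℚ) × (x ≢ - 1ℚ)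

{-# OPTIONS --safe #-}
module Submission where

-- Dividing by one edge, a perfect cuboid is a unit cuboid 1 × p × q, i.e. positive rationals p, q
-- for which 1 + p², 1 + q², p² + q² = u² and 1 + u² are squares.  So a perfect cuboid is the
-- same thing as a Pythagorean triple p² + q² = u² of nonzero rationals each of which has a
-- rational "secant" √(1 + t²).  By the double-angle formula for the tangent, the nonzero t
-- with √(1 + t²) rational are exactly the values 2x/(1 − x²) with x ∉ {0, 1, −1}.

open import Defs
open import Data.Rational using (ℚ; 0ℚ; 1ℚ; _+_; _*_; _-_; -_; 1/_; ∣_∣; _<_; NonZero; _≟_; ≢-nonZero; positive)
open import Data.Rational.Properties
open import Data.Product using (_×_; _,_; ∃-syntax)
open import Data.Sum using (inj₁; inj₂)
open import Function.Base using (_∘′_)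
open import Function.Bundles using (_⇔_; mk⇔)
open import Function.Properties.Equivalence using () renaming (trans to ⇔-trans)
open import Relation.Nullary using (yes; no; contradiction)
open import Relation.Binary.PropositionalEquality
open import Data.Rational.Solver using (module +-*-Solver)
open +-*-Solver using (solve; _:=_; _:+_; _:*_; _:-_; :-_; con)
open ≡-Reasoning

p*q*1/q≡p : ∀ p q .{{_ : NonZero q}} → p * q * 1/ q ≡ p
p*q*1/q≡p p q = begin
  p * q * 1/ q    ≡⟨ *-assoc p q (1/ q) ⟩
  p * (q * 1/ q)  ≡⟨ cong (p *_) (*-inverseʳ q) ⟩
  p * 1ℚ          ≡⟨ *-identityʳ p ⟩
  p               ∎

p*1/q*q≡p : ∀ p q .{{_ : NonZero q}} → p * 1/ q * q ≡ p
p*1/q*q≡p p q = begin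
  p * 1/ q * q    ≡⟨ *-assoc p (1/ q) q ⟩
  p * (1/ q * q)  ≡⟨ cong (p *_) (*-inverseˡ q) ⟩
  p * 1ℚ          ≡⟨ *-identityʳ p ⟩
  p               ∎

*-cancelʳ-≢0 : ∀ {p q r} → r ≢ 0ℚ → p * r ≡ q * r → p ≡ q
*-cancelʳ-≢0 {p} {q} {r} r≢0 pr≡qr = begin
  p             ≡⟨ sym (p*q*1/q≡p p r) ⟩
  p * r * 1/ r  ≡⟨ cong (_* 1/ r) pr≡qr ⟩
  q * r * 1/ r  ≡⟨ p*q*1/q≡p q r ⟩
  q             ∎
  where instance _ = ≢-nonZero r≢0

*-≢0 : ∀ {p q} → p ≢ 0ℚ → q ≢ 0ℚ → p * q ≢ 0ℚ
*-≢0 {p} {q} p≢0 q≢0 pq≡0 = p≢0 (*-cancelʳ-≢0 q≢0 (trans pq≡0 (sym (*-zeroˡ q))))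

≢⇒-≢0 : ∀ {p q} → p ≢ q → p - q ≢ 0ℚ
≢⇒-≢0 {p} {q} p≢q p-q≡0 = p≢q (begin
  p            ≡⟨ solve 2 (λ p q → p := p :- q :+ q) refl p q ⟩
  (p - q) + q  ≡⟨ cong (_+ q) p-q≡0 ⟩
  0ℚ + q       ≡⟨ +-identityˡ q ⟩
  q            ∎)

pos⇒≢0 : ∀ {p} → 0ℚ < p → p ≢ 0ℚ
pos⇒≢0 0<p = ≢-sym (<⇒≢ 0<p)

≢0⇒∣∣-pos : ∀ {p} → p ≢ 0ℚ → 0ℚ < ∣ p ∣
≢0⇒∣∣-pos {p} p≢0 = positive⁻¹ ∣ p ∣
  {{nonNeg∧nonZero⇒pos ∣ p ∣ {{∣-∣-nonNeg p}} {{≢-nonZero (p≢0 ∘′ ∣p∣≡0⇒p≡0 p)}}}}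

*-pos : ∀ {p q} → 0ℚ < p → 0ℚ < q → 0ℚ < p * q
*-pos {p} {q} 0<p 0<q = positive⁻¹ (p * q) {{pos*pos⇒pos p {{positive 0<p}} q {{positive 0<q}}}}

∣p∣*∣p∣≡p*p : ∀ p → ∣ p ∣ * ∣ p ∣ ≡ p * p
∣p∣*∣p∣≡p*p p with ∣p∣≡p∨∣p∣≡-p p
... | inj₁ ∣p∣≡p  = cong₂ _*_ ∣p∣≡p ∣p∣≡p
... | inj₂ ∣p∣≡-p = trans (cong₂ _*_ ∣p∣≡-p ∣p∣≡-p) (solve 1 (λ p → (:- p) :* (:- p) := p :* p) refl p)

IsSquare-*-square : ∀ k {w} → IsSquare w → IsSquare (k * k * w)
IsSquare-*-square k {w} (r , w≡r²) = k * r , (begin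
  k * k * w            ≡⟨ cong (k * k *_) w≡r² ⟩
  k * k * (r * r)      ≡⟨ solve 2 (λ k r → k :* k :* (r :* r) := (k :* r) :* (k :* r)) refl k r ⟩
  (k * r) * (k * r)    ∎)

IsSquare-cancelʳ : ∀ {w d} → d ≢ 0ℚ → IsSquare (w * (d * d)) → IsSquare w
IsSquare-cancelʳ {w} {d} d≢0 (v , wd²≡v²) = v * 1/ d , *-cancelʳ-≢0 (*-≢0 d≢0 d≢0) (begin
  w * (d * d)                        ≡⟨ wd²≡v² ⟩
  v * v                              ≡⟨ cong₂ _*_ (sym (p*q*1/q≡p v d)) (sym (p*q*1/q≡p v d)) ⟩
  (v * d * 1/ d) * (v * d * 1/ d)    ≡⟨ solve 3 (λ v d e → (v :* d :* e) :* (v :* d :* e) := (v :* e) :* (v :* e) :* (d :* d)) refl v d (1/ d) ⟩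
  (v * 1/ d) * (v * 1/ d) * (d * d)  ∎)
  where instance _ = ≢-nonZero d≢0

T-spec : ∀ x → 1ℚ - x * x ≢ 0ℚ → T x * (1ℚ - x * x) ≡ (1ℚ + 1ℚ) * x
T-spec x d≢0 with (1ℚ - x * x) ≟ 0ℚ
... | yes d≡0 = contradiction d≡0 d≢0
... | no  d≢0′ = p*1/q*q≡p ((1ℚ + 1ℚ) * x) (1ℚ - x * x) {{≢-nonZero d≢0′}}

T-unique : ∀ {x t} → 1ℚ - x * x ≢ 0ℚ → t * (1ℚ - x * x) ≡ (1ℚ + 1ℚ) * x → T x ≡ t
T-unique {x} d≢0 td≡2x = *-cancelʳ-≢0 d≢0 (trans (T-spec x d≢0) (sym td≡2x))

admissible⇒1-x²≢0 : ∀ {x} → Admissible x → 1ℚ - x * x ≢ 0ℚ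
admissible⇒1-x²≢0 {x} (_ , x≢1 , x≢-1) 1-x²≡0 = *-≢0 (≢⇒-≢0 (≢-sym x≢1)) (≢⇒-≢0 x≢-1) (begin
  (1ℚ - x) * (x - - 1ℚ)  ≡⟨ solve 1 (λ x → (con 1ℚ :- x) :* (x :- (:- con 1ℚ)) := con 1ℚ :- x :* x) refl x ⟩
  1ℚ - x * x             ≡⟨ 1-x²≡0 ⟩
  0ℚ                     ∎)

RationalSec : ℚ → Set
RationalSec t = t ≢ 0ℚ × IsSquare (1ℚ + t * t)

[1-x²]²+[2x]²≡[1+x²]² : ∀ x → (1ℚ - x * x) * (1ℚ - x * x) + ((1ℚ + 1ℚ) * x) * ((1ℚ + 1ℚ) * x) ≡ (1ℚ + x * x) * (1ℚ + x * x)
[1-x²]²+[2x]²≡[1+x²]² = solve 1 (λ x → (con 1ℚ :- x :* x) :* (con 1ℚ :- x :* x) :+ (con 2ℚ :* x) :* (con 2ℚ :* x)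
                                      := (con 1ℚ :+ x :* x) :* (con 1ℚ :+ x :* x)) refl
  where 2ℚ = 1ℚ + 1ℚ

T-rationalSec : ∀ {x} → Admissible x → RationalSec (T x)
T-rationalSec {x} adm@(x≢0 , _) = T≢0 , IsSquare-cancelʳ d≢0 (1ℚ + x * x , (begin
  (1ℚ + T x * T x) * (d * d)                 ≡⟨ solve 2 (λ t d → (con 1ℚ :+ t :* t) :* (d :* d) := d :* d :+ (t :* d) :* (t :* d)) refl (T x) d ⟩
  d * d + (T x * d) * (T x * d)               ≡⟨ cong (λ z → d * d + z * z) (T-spec x d≢0) ⟩
  d * d + ((1ℚ + 1ℚ) * x) * ((1ℚ + 1ℚ) * x)  ≡⟨ [1-x²]²+[2x]²≡[1+x²]² x ⟩
  (1ℚ + x * x) * (1ℚ + x * x)                 ∎))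
  where
  d = 1ℚ - x * x
  d≢0 = admissible⇒1-x²≢0 adm
  T≢0 : T x ≢ 0ℚ
  T≢0 Tx≡0 = *-≢0 {1ℚ + 1ℚ} (λ ()) x≢0 (begin
    (1ℚ + 1ℚ) * x  ≡⟨ sym (T-spec x d≢0) ⟩
    T x * d        ≡⟨ cong (_* d) Tx≡0 ⟩
    0ℚ * d         ≡⟨ *-zeroˡ d ⟩
    0ℚ             ∎)

-- Half of the angle whose tangent is t has tangent t / (1 + sec), taking the secant s ≥ 0.
T-surjective : ∀ {t} → RationalSec t → ∃[ x ] (Admissible x × T x ≡ t)
T-surjective {t} (t≢0 , s , 1+t²≡s²) = x , (x≢0 , x≢1 , x≢-1) , T-unique {x} d≢0 td≡2x
  where
  S = ∣ s ∣
  e = 1ℚ + S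
  e≢0 : e ≢ 0ℚ
  e≢0 = pos⇒≢0 (+-mono-<-≤ (positive⁻¹ 1ℚ) (0≤∣p∣ s))
  instance _ = ≢-nonZero e≢0
  x = t * 1/ e
  d = 1ℚ - x * x
  xe≡t : x * e ≡ t
  xe≡t = p*1/q*q≡p t e
  de≡2 : d * e ≡ 1ℚ + 1ℚ
  de≡2 = *-cancelʳ-≢0 e≢0 (begin
    d * e * e                             ≡⟨ solve 2 (λ x e → (con 1ℚ :- x :* x) :* e :* e := e :* e :- (x :* e) :* (x :* e)) refl x e ⟩
    e * e - (x * e) * (x * e)             ≡⟨ cong (λ z → e * e - z * z) xe≡t ⟩
    e * e - t * t                         ≡⟨ solve 2 (λ S t → (con 1ℚ :+ S) :* (con 1ℚ :+ S) :- t :* t := (con 1ℚ :+ con 1ℚ) :* S :+ S :* S :- t :* t :+ con 1ℚ) refl S t ⟩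
    (1ℚ + 1ℚ) * S + S * S - t * t + 1ℚ    ≡⟨ cong (λ z → (1ℚ + 1ℚ) * S + z - t * t + 1ℚ) (trans (∣p∣*∣p∣≡p*p s) (sym 1+t²≡s²)) ⟩
    (1ℚ + 1ℚ) * S + (1ℚ + t * t) - t * t + 1ℚ  ≡⟨ solve 2 (λ S t → (con 1ℚ :+ con 1ℚ) :* S :+ (con 1ℚ :+ t :* t) :- t :* t :+ con 1ℚ := (con 1ℚ :+ con 1ℚ) :* (con 1ℚ :+ S)) refl S t ⟩
    (1ℚ + 1ℚ) * e                         ∎)
  d≢0 : d ≢ 0ℚ
  d≢0 d≡0 = contradiction (trans (sym de≡2) (trans (cong (_* e) d≡0) (*-zeroˡ e))) λ ()
  x≢0 : x ≢ 0ℚ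
  x≢0 x≡0 = t≢0 (trans (sym xe≡t) (trans (cong (_* e) x≡0) (*-zeroˡ e)))
  x≢1 : x ≢ 1ℚ
  x≢1 x≡1 = d≢0 (cong (λ z → 1ℚ - z * z) x≡1)
  x≢-1 : x ≢ - 1ℚ
  x≢-1 x≡-1 = d≢0 (cong (λ z → 1ℚ - z * z) x≡-1)
  td≡2x : t * d ≡ (1ℚ + 1ℚ) * x
  td≡2x = *-cancelʳ-≢0 e≢0 (begin
    t * d * e              ≡⟨ *-assoc t d e ⟩
    t * (d * e)            ≡⟨ cong (t *_) de≡2 ⟩
    t * (1ℚ + 1ℚ)          ≡⟨ cong (_* (1ℚ + 1ℚ)) (sym xe≡t) ⟩
    x * e * (1ℚ + 1ℚ)      ≡⟨ solve 3 (λ x e c → x :* e :* c := c :* x :* e) refl x e (1ℚ + 1ℚ) ⟩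
    (1ℚ + 1ℚ) * x * e      ∎)

PerfectCuboid-scale : ∀ {k a b c} → 0ℚ < k → PerfectCuboid a b c → PerfectCuboid (k * a) (k * b) (k * c)
PerfectCuboid-scale {k} {a} {b} {c} 0<k (0<a , 0<b , 0<c , ab , bc , ac , abc) =
  *-pos 0<k 0<a , *-pos 0<k 0<b , *-pos 0<k 0<c ,
  scaled ab (solve 3 (λ k a b → (k :* a) :* (k :* a) :+ (k :* b) :* (k :* b) := k :* k :* (a :* a :+ b :* b)) refl k a b) ,
  scaled bc (solve 3 (λ k b c → (k :* b) :* (k :* b) :+ (k :* c) :* (k :* c) := k :* k :* (b :* b :+ c :* c)) refl k b c) ,
  scaled ac (solve 3 (λ k a c → (k :* a) :* (k :* a) :+ (k :* c) :* (k :* c) := k :* k :* (a :* a :+ c :* c)) refl k a c) ,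
  scaled abc (solve 4 (λ k a b c → (k :* a) :* (k :* a) :+ (k :* b) :* (k :* b) :+ (k :* c) :* (k :* c)
                                  := k :* k :* (a :* a :+ b :* b :+ c :* c)) refl k a b c)
  where
  scaled : ∀ {w v} → IsSquare w → v ≡ k * k * w → IsSquare v
  scaled w□ v≡k²w = subst IsSquare (sym v≡k²w) (IsSquare-*-square k w□)

cuboid⇔unitCuboid : (∃[ a ] ∃[ b ] ∃[ c ] PerfectCuboid a b c) ⇔ (∃[ p ] ∃[ q ] PerfectCuboid 1ℚ p q)
cuboid⇔unitCuboid = mk⇔ normalise (λ (p , q , cuboid) → 1ℚ , p , q , cuboid)
  where
  normalise : (∃[ a ] ∃[ b ] ∃[ c ] PerfectCuboid a b c) → ∃[ p ] ∃[ q ] PerfectCuboid 1ℚ p q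
  normalise (a , b , c , cuboid@(0<a , _)) =
    1/ a * b , 1/ a * c , subst (λ z → PerfectCuboid z (1/ a * b) (1/ a * c)) (*-inverseˡ a) (PerfectCuboid-scale 0<1/a cuboid)
    where
    instance
      _ = positive 0<a
      _ = pos⇒nonZero a
    0<1/a : 0ℚ < 1/ a
    0<1/a = positive⁻¹ (1/ a) {{1/pos⇒pos a}}

PythagoreanSecTriple : ℚ → ℚ → ℚ → Set
PythagoreanSecTriple p q u = RationalSec p × RationalSec q × RationalSec u × p * p + q * q ≡ u * u

unitCuboid⇔secTriple : (∃[ p ] ∃[ q ] PerfectCuboid 1ℚ p q)
  ⇔ (∃[ p ] ∃[ q ] ∃[ u ] PythagoreanSecTriple p q u)
unitCuboid⇔secTriple = mk⇔ to from
  where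
  to : (∃[ p ] ∃[ q ] PerfectCuboid 1ℚ p q)
     → ∃[ p ] ∃[ q ] ∃[ u ] PythagoreanSecTriple p q u
  to (p , q , _ , 0<p , 0<q , 1+p²□ , (u , p²+q²≡u²) , 1+q²□ , (r , 1+p²+q²≡r²)) =
    p , q , u , (pos⇒≢0 0<p , 1+p²□) , (pos⇒≢0 0<q , 1+q²□) , (u≢0 , r , 1+u²≡r²) , p²+q²≡u²
    where
    u≢0 : u ≢ 0ℚ
    u≢0 refl = <⇒≢ (+-mono-< (*-pos 0<p 0<p) (*-pos 0<q 0<q)) (sym p²+q²≡u²)
    1+u²≡r² : 1ℚ + u * u ≡ r * r
    1+u²≡r² = begin
      1ℚ + u * u          ≡⟨ cong (1ℚ +_) (sym p²+q²≡u²) ⟩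
      1ℚ + (p * p + q * q) ≡⟨ sym (+-assoc 1ℚ (p * p) (q * q)) ⟩
      1ℚ + p * p + q * q   ≡⟨ 1+p²+q²≡r² ⟩
      r * r               ∎
  from : (∃[ p ] ∃[ q ] ∃[ u ] PythagoreanSecTriple p q u)
       → ∃[ p ] ∃[ q ] PerfectCuboid 1ℚ p q
  from (p , q , u , (p≢0 , 1+p²□) , (q≢0 , 1+q²□) , (_ , 1+u²□) , p²+q²≡u²) =
    ∣ p ∣ , ∣ q ∣ , positive⁻¹ 1ℚ , ≢0⇒∣∣-pos p≢0 , ≢0⇒∣∣-pos q≢0 ,
    subst IsSquare (1+t²≡1+∣t∣² p) 1+p²□ ,
    (u , trans (cong₂ _+_ (∣p∣*∣p∣≡p*p p) (∣p∣*∣p∣≡p*p q)) p²+q²≡u²) ,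
    subst IsSquare (1+t²≡1+∣t∣² q) 1+q²□ ,
    subst IsSquare 1+u²≡1+∣p∣²+∣q∣² 1+u²□
    where
    1+t²≡1+∣t∣² : ∀ t → 1ℚ + t * t ≡ 1ℚ + ∣ t ∣ * ∣ t ∣
    1+t²≡1+∣t∣² t = cong (1ℚ +_) (sym (∣p∣*∣p∣≡p*p t))
    1+u²≡1+∣p∣²+∣q∣² : 1ℚ + u * u ≡ 1ℚ + ∣ p ∣ * ∣ p ∣ + ∣ q ∣ * ∣ q ∣
    1+u²≡1+∣p∣²+∣q∣² = begin
      1ℚ + u * u                            ≡⟨ cong (1ℚ +_) (sym p²+q²≡u²) ⟩
      1ℚ + (p * p + q * q)                  ≡⟨ sym (+-assoc 1ℚ (p * p) (q * q)) ⟩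
      1ℚ + p * p + q * q                    ≡⟨ cong₂ (λ y z → 1ℚ + y + z) (sym (∣p∣*∣p∣≡p*p p)) (sym (∣p∣*∣p∣≡p*p q)) ⟩
      1ℚ + ∣ p ∣ * ∣ p ∣ + ∣ q ∣ * ∣ q ∣    ∎

HalfAngleTriple : ℚ → ℚ → ℚ → Set
HalfAngleTriple α β γ = Admissible α × Admissible β × Admissible γ × T γ * T γ + T β * T β ≡ T α * T α

secTriple⇔halfAngleTriple : (∃[ p ] ∃[ q ] ∃[ u ] PythagoreanSecTriple p q u)
  ⇔ (∃[ α ] ∃[ β ] ∃[ γ ] HalfAngleTriple α β γ)
secTriple⇔halfAngleTriple = mk⇔ to from
  where
  to : (∃[ p ] ∃[ q ] ∃[ u ] PythagoreanSecTriple p q u)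
     → ∃[ α ] ∃[ β ] ∃[ γ ] HalfAngleTriple α β γ
  to (p , q , u , p-sec , q-sec , u-sec , p²+q²≡u²) = lift (T-surjective p-sec) (T-surjective q-sec) (T-surjective u-sec)
    where
    lift : ∃[ γ ] (Admissible γ × T γ ≡ p) → ∃[ β ] (Admissible β × T β ≡ q) → ∃[ α ] (Admissible α × T α ≡ u)
         → ∃[ α ] ∃[ β ] ∃[ γ ] HalfAngleTriple α β γ
    lift (γ , γ-adm , Tγ≡p) (β , β-adm , Tβ≡q) (α , α-adm , Tα≡u) = α , β , γ , α-adm , β-adm , γ-adm , (begin
      T γ * T γ + T β * T β  ≡⟨ cong₂ (λ y z → y * y + z * z) Tγ≡p Tβ≡q ⟩
      p * p + q * q          ≡⟨ p²+q²≡u² ⟩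
      u * u                  ≡⟨ cong (λ z → z * z) (sym Tα≡u) ⟩
      T α * T α              ∎)
  from : (∃[ α ] ∃[ β ] ∃[ γ ] HalfAngleTriple α β γ)
       → ∃[ p ] ∃[ q ] ∃[ u ] PythagoreanSecTriple p q u
  from (α , β , γ , α-adm , β-adm , γ-adm , pythagoras) =
    T γ , T β , T α , T-rationalSec γ-adm , T-rationalSec β-adm , T-rationalSec α-adm , pythagoras

theorem2 : (∃[ a ] ∃[ b ] ∃[ c ] PerfectCuboid a b c)
           ⇔ (∃[ α ] ∃[ β ] ∃[ γ ] (Admissible α × Admissible β × Admissible γ
                × (T γ * T γ + T β * T β ≡ T α * T α)))
theorem2 = ⇔-trans cuboid⇔unitCuboid (⇔-trans unitCuboid⇔secTriple secTriple⇔halfAngleTriple)
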